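{- If $E\subseteq 2^\omega$ is porous, then there exists $k\in\mathbb{N}$ such that for all $m\in\mathbb{N}$, all $\alpha\in 2^m$ and all $\tau\in 2^{m+k}$ there exists $\beta\in 2^{m+k}$ such that $\alpha\subseteq\beta$ and $([\tau]+[\beta])\cap E=\emptyset$.
   Context: $2^\omega$ is the Cantor space with coordinatewise addition modulo 2; $A+B=\{a+b:a\in A,b\in B\}$; $[\beta]=\{x\in2^\omega:\beta\subseteq x\}$; $2^m$ is the set of binary sequences of length $m$. $E\subseteq 2^\omega$ is porous if there exists $k$ such that for every $m$ and every $\alpha\in 2^m$ there is $\beta\in 2^{m+k}$ with $\alpha\subseteq\beta$ and $[\beta]\cap E=\emptyset$. -}

module Defs where

open import Data.Nat using (ℕ; _+_)
open import Data.Bool using (Bool; _xor_)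
open import Data.Fin using (Fin; toℕ)
open import Data.Vec using (Vec; lookup; take)
open import Data.Product using (Σ; _×_)
open import Relation.Binary.PropositionalEquality using (_≡_)
open import Relation.Nullary using (¬_)
open import Level using (Level; _⊔_)

Cantor : Set
Cantor = ℕ → Bool

_⊕_ : Cantor → Cantor → Cantor
(x ⊕ y) n = x n xor y n

_∈[_] : {m : ℕ} → Cantor → Vec Bool m → Set
_∈[_] {m} x s = (i : Fin m) → x (toℕ i) ≡ lookup s i

_⊑_ : {m k : ℕ} → Vec Bool m → Vec Bool (m + k) → Set
_⊑_ {m} α β = take m β ≡ α

DisjointCyl : ∀ {ℓ} {n : ℕ} → Vec Bool n → (Cantor → Set ℓ) → Set ℓ
DisjointCyl β E = ∀ x → x ∈[ β ] → ¬ E x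

DisjointSumCyl : ∀ {ℓ} {n : ℕ} → Vec Bool n → Vec Bool n → (Cantor → Set ℓ) → Set ℓ
DisjointSumCyl τ β E = ∀ x y → x ∈[ τ ] → y ∈[ β ] → ¬ E (x ⊕ y)

Porous : ∀ {ℓ} → (Cantor → Set ℓ) → Set ℓ
Porous E = Σ ℕ λ k → (m : ℕ) (α : Vec Bool m) →
  Σ (Vec Bool (m + k)) λ β → (_⊑_ {m} {k} α β) × DisjointCyl β E

{-# OPTIONS --safe #-}
module Submission where

open import Defs
open import Data.Nat using (ℕ; _+_)
open import Data.Bool using (Bool; false; _xor_)
open import Data.Bool.Properties using (xor-assoc; xor-same)
open import Data.Vec using (Vec; []; _∷_; zipWith; take)
open import Data.Vec.Properties using (take-zipWith; lookup-zipWith)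
open import Data.Product using (Σ; _×_; _,_)
open import Level using (Level)
open import Relation.Binary.PropositionalEquality
  using (_≡_; refl; sym; trans; cong; cong₂; subst; module ≡-Reasoning)

-- Translation by τ maps cylinders onto cylinders, and [τ] + [β] ⊆ [τ ⊕ β].
-- So take a hole [γ] of E below the translated prefix (τ↾m) ⊕ α and put
-- β = τ ⊕ γ: then β extends α and [τ] + [β] ⊆ [γ].

xor-cancelˡ : ∀ x y → x xor (x xor y) ≡ y
xor-cancelˡ x y = begin
  x xor (x xor y)  ≡⟨ xor-assoc x x y ⟨
  (x xor x) xor y  ≡⟨ cong (_xor y) (xor-same x) ⟩
  false xor y      ∎
  where open ≡-Reasoning

infixl 6 _⊕ᵛ_

_⊕ᵛ_ : ∀ {n} → Vec Bool n → Vec Bool n → Vec Bool n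
_⊕ᵛ_ = zipWith _xor_

⊕ᵛ-cancelˡ : ∀ {n} (s t : Vec Bool n) → s ⊕ᵛ (s ⊕ᵛ t) ≡ t
⊕ᵛ-cancelˡ []       []       = refl
⊕ᵛ-cancelˡ (x ∷ xs) (y ∷ ys) = cong₂ _∷_ (xor-cancelˡ x y) (⊕ᵛ-cancelˡ xs ys)

⊕-∈[] : ∀ {n} (x y : Cantor) (s t : Vec Bool n) →
        x ∈[ s ] → y ∈[ t ] → (x ⊕ y) ∈[ s ⊕ᵛ t ]
⊕-∈[] x y s t x∈s y∈t i =
  trans (cong₂ _xor_ (x∈s i) (y∈t i)) (sym (lookup-zipWith _xor_ i s t))

disjointCyl⇒disjointSumCyl : ∀ {ℓ n} {E : Cantor → Set ℓ} (τ β : Vec Bool n) →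
                             DisjointCyl (τ ⊕ᵛ β) E → DisjointSumCyl τ β E
disjointCyl⇒disjointSumCyl τ β [τ⊕β]∩E=∅ x y x∈τ y∈β =
  [τ⊕β]∩E=∅ (x ⊕ y) (⊕-∈[] x y τ β x∈τ y∈β)

⊑-translate : ∀ {m k} (τ : Vec Bool (m + k)) {α : Vec Bool m} {γ : Vec Bool (m + k)} →
              _⊑_ {m} {k} α γ → _⊑_ {m} {k} (take m τ ⊕ᵛ α) (τ ⊕ᵛ γ)
⊑-translate {m} τ {α} {γ} α⊑γ = begin
  take m (τ ⊕ᵛ γ)         ≡⟨ take-zipWith _xor_ τ γ ⟩
  take m τ ⊕ᵛ take m γ    ≡⟨ cong (take m τ ⊕ᵛ_) α⊑γ ⟩
  take m τ ⊕ᵛ α           ∎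
  where open ≡-Reasoning

mainTheorem11 : ∀ {ℓ : Level} (E : Cantor → Set ℓ) → Porous E →
    Σ ℕ λ k → (m : ℕ) (α : Vec Bool m) (τ : Vec Bool (m + k)) →
    Σ (Vec Bool (m + k)) λ β → (_⊑_ {m} {k} α β) × DisjointSumCyl τ β E
mainTheorem11 E (k , porous) = k , λ m α τ →
  let τ↾m = take m τ
      (γ , τ↾m⊕α⊑γ , [γ]∩E=∅) = porous m (τ↾m ⊕ᵛ α)
  in τ ⊕ᵛ γ
   , subst (λ a → _⊑_ {m} {k} a (τ ⊕ᵛ γ)) (⊕ᵛ-cancelˡ τ↾m α) (⊑-translate τ τ↾m⊕α⊑γ)
   , disjointCyl⇒disjointSumCyl τ (τ ⊕ᵛ γ)
       (subst (λ s → DisjointCyl s E) (sym (⊕ᵛ-cancelˡ τ γ)) [γ]∩E=∅)
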